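{- Let $G$ be a finite, simple, connected graph of order $n\ge 4$. If there exists a vertex $u\in V(G)$ with $\deg(u)=n-3$ such that the two vertices of $V(G)\setminus N[u]$ are not twins, then $\gamma_P(G)=1$.
   Context: Two vertices $x,y$ are twins if $N(x)=N(y)$ or $N[x]=N[y]$. Zero forcing: for $U\subseteq V(G)$ (black vertices), repeatedly apply the rule "if a black vertex has exactly one white neighbor, that neighbor becomes black"; the resulting set is the closure $cl(U)$. A set $S$ is a power dominating set if $cl(N[S])=V(G)$, where $N[S]$ is the closed neighborhood of $S$; $\gamma_P(G)$ is the minimum cardinality of a power dominating set. -}

module Defs where

open import Data.Nat using (ℕ; _∸_; _≤_)
open import Data.Bool using (Bool; true; false; _∨_)
open import Data.Fin using (Fin; _≟_)
open import Data.Fin.Subset using (Subset; _∈_; ∣_∣)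
open import Data.Vec using (tabulate)
open import Data.Product using (_×_; ∃)
open import Data.Sum using (_⊎_)
open import Relation.Nullary using (¬_; Dec; yes; no)
open import Relation.Binary.PropositionalEquality using (_≡_; _≢_)

record Graph (n : ℕ) : Set where
  field
    adj    : Fin n → Fin n → Bool
    sym    : ∀ x y → adj x y ≡ adj y x
    irrefl : ∀ x → adj x x ≡ false

module _ {n : ℕ} (G : Graph n) where
  open Graph G

  Adj : Fin n → Fin n → Set
  Adj x y = adj x y ≡ true

  data Reachable (x : Fin n) : Fin n → Set where
    here : Reachable x x
    step : ∀ {y z} → Reachable x y → Adj y z → Reachable x z

  Connected : Set
  Connected = ∀ x y → Reachable x y

  eqB : Fin n → Fin n → Bool
  eqB x y with x ≟ y
  ... | yes _ = true
  ... | no  _ = false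

  N : Fin n → Subset n
  N x = tabulate (adj x)

  N[_] : Fin n → Subset n
  N[ x ] = tabulate (λ z → eqB x z ∨ adj x z)

  deg : Fin n → ℕ
  deg x = ∣ N x ∣

  NS[_] : Subset n → Fin n → Set
  NS[ S ] v = ∃ λ s → s ∈ S × (s ≡ v ⊎ Adj s v)

  Twins : Fin n → Fin n → Set
  Twins x y = N x ≡ N y ⊎ N[ x ] ≡ N[ y ]

  -- Zero forcing closure cl(U): least set containing U and closed under the
  -- forcing rule "a black vertex w all of whose neighbours other than v are
  -- black forces its neighbour v".
  data InCl (U : Fin n → Set) : Fin n → Set where
    init  : ∀ {v} → U v → InCl U v
    force : ∀ {v} (w : Fin n) → InCl U w → Adj w v
          → (∀ x → Adj w x → x ≢ v → InCl U x) → InCl U v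

  IsPDS : Subset n → Set
  IsPDS S = ∀ v → InCl NS[ S ] v

  γP≡ : ℕ → Set
  γP≡ k = (∃ λ S → IsPDS S × ∣ S ∣ ≡ k) × (∀ S → IsPDS S → k ≤ ∣ S ∣)

-- Take S = {u}. Initially N[u] is black, and since |N[u]| = n − 2 at most two
-- vertices a, b are white. As a and b are not twins, some vertex y ≠ a, b is
-- adjacent to exactly one of them, say a; such a y lies in N[u], so it is black
-- and forces a. Now b is the only white vertex, and in a connected graph the
-- last white vertex is always forced by the black vertex preceding it on a walk.
-- A power dominating set is nonempty, so γ_P(G) = 1.
module Submission where

open import Defs
open import Data.Nat using (ℕ; suc; _∸_; _≤_; z≤n; s≤s)
open import Data.Nat.Properties using (≤-trans; <⇒≤; ∸-monoʳ-≤; m+n∸n≡m; ≤⇒≯; module ≤-Reasoning)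
open import Data.Bool using (Bool; true; false; _∨_)
import Data.Bool.Properties as Bool
open import Data.Fin using (Fin; _≟_)
open import Data.Fin.Properties using (any?)
open import Data.Fin.Subset using (Subset; _∈_; _∉_; _⊂_; ∁; ∣_∣; ⁅_⁆)
open import Data.Fin.Subset.Properties
  using (_∈?_; x∈⁅x⁆; ∣⁅x⁆∣≡1; x∈p⇒∣p-x∣<∣p∣; x∈p∧x≢y⇒x∈p-y; p⊂q⇒∣p∣<∣q∣;
         ∣∁p∣≡n∸∣p∣; x∉p⇒x∈∁p)
open import Data.Vec using (tabulate)
open import Data.Vec.Properties using (lookup∘tabulate; tabulate-cong; []=⇒lookup; lookup⇒[]=)
open import Data.Product using (_×_; ∃; _,_)
import Data.Sum as Sum
open import Data.Sum using (_⊎_; inj₁; inj₂)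
open import Data.Empty using (⊥; ⊥-elim)
open import Relation.Nullary using (¬_; yes; no; contradiction)
open import Relation.Nullary.Decidable using (¬?; _×-dec_; decidable-stable)
open import Relation.Binary.PropositionalEquality using (_≡_; _≢_; refl; sym; trans; cong; subst; ≢-sym)

∈-tabulate⁻ : ∀ {n} (f : Fin n → Bool) {x} → x ∈ tabulate f → f x ≡ true
∈-tabulate⁻ f {x} x∈ = trans (sym (lookup∘tabulate f x)) ([]=⇒lookup x∈)

∈-tabulate⁺ : ∀ {n} (f : Fin n → Bool) {x} → f x ≡ true → x ∈ tabulate f
∈-tabulate⁺ f {x} fx = lookup⇒[]= x (tabulate f) (trans (lookup∘tabulate f x) fx)

∈⇒1≤∣p∣ : ∀ {n} {p : Subset n} {x} → x ∈ p → 1 ≤ ∣ p ∣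
∈⇒1≤∣p∣ x∈p = ≤-trans (s≤s z≤n) (x∈p⇒∣p-x∣<∣p∣ x∈p)

distinct₃⇒3≤∣p∣ : ∀ {n} {p : Subset n} {x y z} → x ∈ p → y ∈ p → z ∈ p →
                  x ≢ y → x ≢ z → y ≢ z → 3 ≤ ∣ p ∣
distinct₃⇒3≤∣p∣ x∈p y∈p z∈p x≢y x≢z y≢z =
  ≤-trans (s≤s (s≤s (∈⇒1≤∣p∣ z∈p-x-y)))
          (≤-trans (s≤s (x∈p⇒∣p-x∣<∣p∣ y∈p-x)) (x∈p⇒∣p-x∣<∣p∣ x∈p))
  where
  y∈p-x = x∈p∧x≢y⇒x∈p-y y∈p (≢-sym x≢y)
  z∈p-x-y = x∈p∧x≢y⇒x∈p-y (x∈p∧x≢y⇒x∈p-y z∈p (≢-sym x≢z)) (≢-sym y≢z)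

≢⇒true-false : ∀ {p q : Bool} → p ≢ q → p ≡ true × q ≡ false ⊎ q ≡ true × p ≡ false
≢⇒true-false {true}  {true}  p≢q = ⊥-elim (p≢q refl)
≢⇒true-false {true}  {false} _   = inj₁ (refl , refl)
≢⇒true-false {false} {true}  _   = inj₂ (refl , refl)
≢⇒true-false {false} {false} p≢q = ⊥-elim (p≢q refl)

module _ {n : ℕ} (G : Graph n) where
  open Graph G renaming (sym to adj-sym)

  eqB-refl : ∀ x → eqB G x x ≡ true
  eqB-refl x with x ≟ x
  ... | yes _   = refl
  ... | no x≢x = ⊥-elim (x≢x refl)

  eqB-≢ : ∀ {x y} → x ≢ y → eqB G x y ≡ false
  eqB-≢ {x} {y} x≢y with x ≟ y
  ... | yes x≡y = ⊥-elim (x≢y x≡y)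
  ... | no _    = refl

  eqB⇒≡ : ∀ {x y} → eqB G x y ≡ true → x ≡ y
  eqB⇒≡ {x} {y} e with x ≟ y
  ... | yes x≡y = x≡y

  ∈N[]⁻ : ∀ {u x} → x ∈ N[_] G u → u ≡ x ⊎ Adj G u x
  ∈N[]⁻ {u} {x} x∈ with eqB G u x in e | ∈-tabulate⁻ (λ z → eqB G u z ∨ adj u z) x∈
  ... | true  | _   = inj₁ (eqB⇒≡ e)
  ... | false | u~x = inj₂ u~x

  u∈N[u] : ∀ u → u ∈ N[_] G u
  u∈N[u] u = ∈-tabulate⁺ (λ z → eqB G u z ∨ adj u z)
               (subst (λ b → b ∨ adj u u ≡ true) (sym (eqB-refl u)) refl)

  N⊂N[] : ∀ u → N G u ⊂ N[_] G u
  N⊂N[] u = N⊆N[] , u , u∈N[u] u , u∉N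
    where
    N⊆N[] : ∀ {x} → x ∈ N G u → x ∈ N[_] G u
    N⊆N[] {x} x∈ = ∈-tabulate⁺ (λ z → eqB G u z ∨ adj u z)
                     (subst (λ b → eqB G u x ∨ b ≡ true) (sym (∈-tabulate⁻ (adj u) x∈))
                            (Bool.∨-zeroʳ _))
    u∉N : u ∉ N G u
    u∉N u∈ with trans (sym (irrefl u)) (∈-tabulate⁻ (adj u) u∈)
    ... | ()

  agree⇒Twins : ∀ {a b} → a ≢ b → (∀ z → z ≢ a → z ≢ b → adj z a ≡ adj z b) → Twins G a b
  agree⇒Twins {a} {b} a≢b agree with adj a b in ab
  ... | false = inj₁ (tabulate-cong sameN)
    where
    sameN : ∀ z → adj a z ≡ adj b z
    sameN z with z ≟ a | z ≟ b
    ... | yes refl | _        = trans (irrefl a) (sym (trans (adj-sym b a) ab))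
    ... | no _     | yes refl = trans ab (sym (irrefl b))
    ... | no z≢a   | no z≢b   = trans (adj-sym a z) (trans (agree z z≢a z≢b) (adj-sym z b))
  ... | true = inj₂ (tabulate-cong sameN[])
    where
    sameN[] : ∀ z → eqB G a z ∨ adj a z ≡ eqB G b z ∨ adj b z
    sameN[] z with z ≟ a | z ≟ b
    ... | yes refl | _ rewrite eqB-refl a | eqB-≢ (≢-sym a≢b) = sym (trans (adj-sym b a) ab)
    ... | no _ | yes refl rewrite eqB-refl b | eqB-≢ a≢b = ab
    ... | no z≢a | no z≢b rewrite eqB-≢ (≢-sym z≢a) | eqB-≢ (≢-sym z≢b) =
      trans (adj-sym a z) (trans (agree z z≢a z≢b) (adj-sym z b))

  lastStep : ∀ {s v} → Reachable G s v → s ≢ v → ∃ λ y → y ≢ v × Adj G y v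
  lastStep here s≢s = ⊥-elim (s≢s refl)
  lastStep {v = v} (step {y} walk y~v) s≢v with y ≟ v
  ... | no y≢v  = y , y≢v , y~v
  ... | yes refl = lastStep walk s≢v

  InCl⇒∃ : ∀ {U v} → InCl G U v → ∃ U
  InCl⇒∃ (init Uv)        = _ , Uv
  InCl⇒∃ (force _ cw _ _) = InCl⇒∃ cw

  allButOne⇒all : ∀ {U s v} → Connected G → InCl G U s →
                  (∀ x → x ≢ v → InCl G U x) → ∀ x → InCl G U x
  allButOne⇒all {s = s} {v} conn cs others x with x ≟ v
  ... | no x≢v  = others x x≢v
  ... | yes refl = lastWhite
    where
    lastWhite : InCl G _ v
    lastWhite with s ≟ v
    ... | yes refl = cs
    ... | no s≢v with lastStep (conn s v) s≢v
    ... | y , y≢v , y~v = force y (others y y≢v) y~v (λ z _ z≢v → others z z≢v)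

  PDS⇒1≤∣S∣ : ∀ {S} → Fin n → IsPDS G S → 1 ≤ ∣ S ∣
  PDS⇒1≤∣S∣ v pds with InCl⇒∃ (pds v)
  ... | _ , _ , s∈S , _ = ∈⇒1≤∣p∣ s∈S

n∸[1+n∸3]≡2 : ∀ n → 3 ≤ n → n ∸ suc (n ∸ 3) ≡ 2
n∸[1+n∸3]≡2 (suc (suc (suc k))) (s≤s (s≤s (s≤s _))) = m+n∸n≡m 2 k

module _ {n : ℕ} (G : Graph n) (u : Fin n) where
  open Graph G using (adj)

  N[u] : Subset n
  N[u] = N[_] G u

  Black : Fin n → Set
  Black = InCl G (NS[_] G ⁅ u ⁆)

  N[u]⊆Black : ∀ {x} → x ∈ N[u] → Black x
  N[u]⊆Black x∈ = init (u , x∈⁅x⁆ u , ∈N[]⁻ G x∈)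

  ∣∁N[u]∣≤2 : 3 ≤ n → deg G u ≡ n ∸ 3 → ∣ ∁ N[u] ∣ ≤ 2
  ∣∁N[u]∣≤2 3≤n deg≡ = begin
    ∣ ∁ N[u] ∣         ≡⟨ ∣∁p∣≡n∸∣p∣ N[u] ⟩
    n ∸ ∣ N[u] ∣       ≤⟨ ∸-monoʳ-≤ n (p⊂q⇒∣p∣<∣q∣ (N⊂N[] G u)) ⟩
    n ∸ suc (deg G u)  ≡⟨ cong (λ d → n ∸ suc d) deg≡ ⟩
    n ∸ suc (n ∸ 3)    ≡⟨ n∸[1+n∸3]≡2 n 3≤n ⟩
    2                  ∎
    where open ≤-Reasoning

  atMostTwoOutside : 3 ≤ n → deg G u ≡ n ∸ 3 → ∀ {x y z} →
                     x ∉ N[u] → y ∉ N[u] → z ∉ N[u] → x ≢ y → x ≢ z → y ≢ z → ⊥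
  atMostTwoOutside 3≤n deg≡ x∉ y∉ z∉ x≢y x≢z y≢z =
    ≤⇒≯ (∣∁N[u]∣≤2 3≤n deg≡)
        (distinct₃⇒3≤∣p∣ (x∉p⇒x∈∁p x∉) (x∉p⇒x∈∁p y∉) (x∉p⇒x∈∁p z∉) x≢y x≢z y≢z)

  OnlyOutside : Fin n → Fin n → Set
  OnlyOutside a b = ∀ x → x ∉ N[u] → x ≡ a ⊎ x ≡ b

  onlyOutside : 3 ≤ n → deg G u ≡ n ∸ 3 → ∀ {a b} → a ≢ b →
                a ∉ N[u] → b ∉ N[u] → OnlyOutside a b
  onlyOutside 3≤n deg≡ {a} {b} a≢b a∉ b∉ x x∉ with x ≟ a | x ≟ b
  ... | yes x≡a | _       = inj₁ x≡a
  ... | no _    | yes x≡b = inj₂ x≡b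
  ... | no x≢a  | no x≢b  =
    ⊥-elim (atMostTwoOutside 3≤n deg≡ a∉ b∉ x∉ a≢b (≢-sym x≢a) (≢-sym x≢b))

  only⇒∈N[u] : ∀ {a b x} → OnlyOutside a b → x ≢ a → x ≢ b → x ∈ N[u]
  only⇒∈N[u] {x = x} only x≢a x≢b =
    decidable-stable (x ∈? N[u]) (λ x∉ → Sum.[ x≢a , x≢b ] (only x x∉))

  distinguisher : ∀ {a b} → a ≢ b → OnlyOutside a b → ¬ Twins G a b →
                  ∃ λ y → y ∈ N[u] × adj y a ≢ adj y b
  distinguisher {a} {b} a≢b only notTwins
    with any? (λ y → (y ∈? N[u]) ×-dec ¬? (adj y a Bool.≟ adj y b))
  ... | yes found = found
  ... | no none = ⊥-elim (notTwins (agree⇒Twins G a≢b agree))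
    where
    agree : ∀ z → z ≢ a → z ≢ b → adj z a ≡ adj z b
    agree z z≢a z≢b with adj z a Bool.≟ adj z b
    ... | yes same = same
    ... | no differ = ⊥-elim (none (z , only⇒∈N[u] only z≢a z≢b , differ))

  forcedByDistinguisher : ∀ {a b y} → OnlyOutside a b → y ∈ N[u] →
                          adj y a ≡ true → adj y b ≡ false → ∀ x → x ≢ b → Black x
  forcedByDistinguisher {a} {b} {y} only y∈ y~a y≁b x x≢b with x ≟ a
  ... | yes refl = force y (N[u]⊆Black y∈) y~a
                     (λ z y~z z≢a → N[u]⊆Black (only⇒∈N[u] only z≢a λ { refl → ¬y~b y~z }))
    where
    ¬y~b : ¬ Adj G y b
    ¬y~b y~b = contradiction (trans (sym y~b) y≁b) λ ()
  ... | no x≢a = N[u]⊆Black (only⇒∈N[u] only x≢a x≢b)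

  NoOutsideTwins : Set
  NoOutsideTwins = ∀ x y → x ≢ y → x ∉ N[u] → y ∉ N[u] → ¬ Twins G x y

  twoOutside⇒allButOneBlack : NoOutsideTwins → ∀ {a b} → a ≢ b →
                              a ∉ N[u] → b ∉ N[u] → OnlyOutside a b →
                              ∃ λ v → ∀ x → x ≢ v → Black x
  twoOutside⇒allButOneBlack notTwins {a} {b} a≢b a∉ b∉ only
    with distinguisher a≢b only (notTwins a b a≢b a∉ b∉)
  ... | y , y∈ , differ with ≢⇒true-false differ
  ... | inj₁ (y~a , y≁b) = b , forcedByDistinguisher only y∈ y~a y≁b
  ... | inj₂ (y~b , y≁a) = a , forcedByDistinguisher (λ x x∉ → Sum.swap (only x x∉)) y∈ y~b y≁a

  allButOneBlack : 3 ≤ n → deg G u ≡ n ∸ 3 → NoOutsideTwins → ∃ λ v → ∀ x → x ≢ v → Black x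
  allButOneBlack 3≤n deg≡ notTwins with any? (λ a → ¬? (a ∈? N[u]))
  ... | no noneOutside =
    u , λ x _ → N[u]⊆Black (decidable-stable (x ∈? N[u]) (λ x∉ → noneOutside (x , x∉)))
  ... | yes (a , a∉) with any? (λ b → ¬? (b ≟ a) ×-dec ¬? (b ∈? N[u]))
  ... | no onlyA =
    a , λ x x≢a → N[u]⊆Black (decidable-stable (x ∈? N[u]) (λ x∉ → onlyA (x , x≢a , x∉)))
  ... | yes (b , b≢a , b∉) =
    twoOutside⇒allButOneBlack notTwins (≢-sym b≢a) a∉ b∉
                              (onlyOutside 3≤n deg≡ (≢-sym b≢a) a∉ b∉)

mainTheorem7 : (n : ℕ) → 4 ≤ n → (G : Graph n) → Connected G →
    (u : Fin n) → deg G u ≡ n ∸ 3 →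
    (∀ x y → x ≢ y → x ∉ N[_] G u → y ∉ N[_] G u → ¬ Twins G x y) →
    γP≡ G 1
mainTheorem7 n 4≤n G conn u deg≡ notTwins =
  (⁅ u ⁆ , ⁅u⁆-isPDS , ∣⁅x⁆∣≡1 u) , λ S isPDS → PDS⇒1≤∣S∣ G u isPDS
  where
  ⁅u⁆-isPDS : IsPDS G ⁅ u ⁆
  ⁅u⁆-isPDS with allButOneBlack G u (<⇒≤ 4≤n) deg≡ notTwins
  ... | _ , others = allButOne⇒all G conn (N[u]⊆Black G u (u∈N[u] G u)) others
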